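{- Every valid formula is derivable in the system $\mathbf{Mp}$.
   Context: Formulas are built from literals, namely propositional variables $P,Q,\dots$ and their formal complements $\bar P,\bar Q,\dots$, using the binary connectives $\wedge$ and $\vee$. Negation is the operation $\neg P=\bar P$, $\neg\bar P=P$, extended by De Morgan's laws. A sequent is a nonempty finite multiset of formulas. A comma denotes multiset union, and $\Gamma,\Delta,\Sigma$ denote possibly empty multisets of formulas. A formula is valid if it evaluates to $1$ under every $0/1$-assignment to its variables, with $\bar P$ read as the complement of $P$. The system $\mathbf{Mp}$ has the following rules: - Axiom: infer $P,\neg P$ from no premises, for each propositional variable $P$. - Blended conjunction $(\wedge)$: from $\Gamma,\Delta,A$ and $\Gamma,\Sigma,B$ infer $\Gamma,\Delta,\Sigma,A\wedge B$. - $(\mathrm{par})$: from $\Gamma,A,B$ infer $\Gamma,A\vee B$. - $(\oplus_i)$ for $i=1,2$: from $\Gamma,A_i$ infer $\Gamma,A_1\vee A_2$. A formula is derivable if the one-element sequent consisting of it is the root of a finite derivation tree built from these rules. -}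

module Defs where

open import Data.Nat using (ℕ)
open import Data.Bool using (Bool; true; false; not; _∧_; _∨_)
open import Data.List using (List; []; _∷_; _++_)
open import Data.List.Relation.Binary.Permutation.Propositional using (_↭_)
open import Relation.Binary.PropositionalEquality using (_≡_)

data Formula : Set where
  pos  : ℕ → Formula
  neg  : ℕ → Formula
  _⊓_  : Formula → Formula → Formula
  _⊔_  : Formula → Formula → Formula

infixr 6 _⊓_
infixr 5 _⊔_

¬F : Formula → Formula
¬F (pos n) = neg n
¬F (neg n) = pos n
¬F (A ⊓ B) = ¬F A ⊔ ¬F B
¬F (A ⊔ B) = ¬F A ⊓ ¬F B

eval : (ℕ → Bool) → Formula → Bool
eval ρ (pos n) = ρ n
eval ρ (neg n) = not (ρ n)
eval ρ (A ⊓ B) = eval ρ A ∧ eval ρ B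
eval ρ (A ⊔ B) = eval ρ A ∨ eval ρ B

Valid : Formula → Set
Valid A = ∀ (ρ : ℕ → Bool) → eval ρ A ≡ true

-- Sequents are finite multisets, represented as lists taken up to permutation
-- (the rule `perm` realises multiset equality).
Sequent : Set
Sequent = List Formula

data Mp : Sequent → Set where
  perm : ∀ {Γ Δ} → Γ ↭ Δ → Mp Γ → Mp Δ
  ax   : ∀ n → Mp (pos n ∷ ¬F (pos n) ∷ [])
  conj : ∀ Γ Δ Σ A B → Mp (Γ ++ Δ ++ A ∷ []) → Mp (Γ ++ Σ ++ B ∷ [])
       → Mp (Γ ++ Δ ++ Σ ++ (A ⊓ B) ∷ [])
  par  : ∀ Γ A B → Mp (Γ ++ A ∷ B ∷ []) → Mp (Γ ++ (A ⊔ B) ∷ [])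
  ⊕₁   : ∀ Γ A B → Mp (Γ ++ A ∷ []) → Mp (Γ ++ (A ⊔ B) ∷ [])
  ⊕₂   : ∀ Γ A B → Mp (Γ ++ B ∷ []) → Mp (Γ ++ (A ⊔ B) ∷ [])

Derivable : Formula → Set
Derivable A = Mp (A ∷ [])

-- Mp has no weakening, so we prove the stronger invariant that every valid
-- sequent Γ has a derivable sub-multiset.  Decomposing a compound formula
-- preserves it: a derivation inside A, B, Γ either uses A or B, and then par
-- or ⊕ᵢ rebuilds A ∨ B, or it already lives inside Γ.  For A ∧ B, if either
-- premise's derivation avoids its conjunct we are done; otherwise both contexts
-- are sub-multisets of Γ, and splitting them into a shared part and two private
-- parts is exactly the shape the blended conjunction rule combines.  A valid
-- sequent of literals contains a complementary pair, i.e. an axiom.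

module Submission where

open import Defs
open import Data.Nat using (ℕ; suc; _+_; _<_; s≤s; _≟_)
open import Data.Nat.Properties using (+-assoc; ≤-reflexive; m≤m+n; m≤n+m; +-monoˡ-≤; <-≤-trans)
open import Data.Nat.Induction using (<-wellFounded)
open import Data.Nat.ListAction using (sum)
open import Data.Nat.ListAction.Properties using (sum-↭)
open import Data.Bool using (T)
open import Data.Bool.Properties using (T-∧; T-∨; T-≡)
open import Data.List using (List; []; _∷_; _++_; [_]; map)
open import Data.List.Properties using (++-assoc; ++-conicalʳ)
open import Data.List.Relation.Unary.Any using (Any; here; there; any?)
open import Data.List.Relation.Unary.All as All using (All; []; _∷_)
open import Data.List.Membership.Propositional using (_∈_; find)
open import Data.List.Relation.Binary.Sublist.Propositional using (_⊆_; []; _∷_; _∷ʳ_; from∈)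
open import Data.List.Relation.Binary.Permutation.Propositional as ↭ using (_↭_; prep; swap; ↭-refl; ↭-sym; ↭-trans)
open import Data.List.Relation.Binary.Permutation.Propositional.Properties using (++-comm; ++⁺ˡ; shift; map⁺; ↭-empty-inv; Any-resp-↭)
open import Data.Product using (∃-syntax; _×_; _,_; proj₁; proj₂)
open import Data.Sum using (inj₁; inj₂)
open import Function using (_∘_)
open import Function.Bundles using (Equivalence)
open import Induction.WellFounded using (Acc; acc)
open import Relation.Nullary using (Dec; no; contradiction)
open import Relation.Nullary.Decidable using (isYes; map′; toWitness; toWitnessFalse)
open import Relation.Binary.PropositionalEquality as Eq using (_≡_; _≢_; refl; sym; cong; subst)

module _ {a} {A : Set a} where

  ⊆-transport : ∀ {xs ys zs : List A} → xs ⊆ ys → ys ↭ zs → ∃[ xs′ ] xs ↭ xs′ × xs′ ⊆ zs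
  ⊆-transport p ↭.refl = _ , ↭-refl , p
  ⊆-transport (y ∷ʳ p) (prep y ρ) =
    let (xs′ , σ , q) = ⊆-transport p ρ in xs′ , σ , y ∷ʳ q
  ⊆-transport (refl ∷ p) (prep x ρ) =
    let (xs′ , σ , q) = ⊆-transport p ρ in x ∷ xs′ , prep x σ , refl ∷ q
  ⊆-transport (x ∷ʳ y ∷ʳ p) (swap x y ρ) =
    let (xs′ , σ , q) = ⊆-transport p ρ in xs′ , σ , y ∷ʳ x ∷ʳ q
  ⊆-transport (x ∷ʳ refl ∷ p) (swap x y ρ) =
    let (xs′ , σ , q) = ⊆-transport p ρ in y ∷ xs′ , prep y σ , refl ∷ x ∷ʳ q
  ⊆-transport (refl ∷ y ∷ʳ p) (swap x y ρ) =
    let (xs′ , σ , q) = ⊆-transport p ρ in x ∷ xs′ , prep x σ , y ∷ʳ refl ∷ q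
  ⊆-transport (refl ∷ refl ∷ p) (swap x y ρ) =
    let (xs′ , σ , q) = ⊆-transport p ρ in y ∷ x ∷ xs′ , swap x y σ , refl ∷ refl ∷ q
  ⊆-transport p (↭.trans ρ ρ′) =
    let (xs′ , σ , q) = ⊆-transport p ρ
        (xs″ , σ′ , q′) = ⊆-transport q ρ′
    in xs″ , ↭-trans σ σ′ , q′

  record Overlap (S T Γ : List A) : Set a where
    field
      shared onlyˡ onlyʳ union : List A
      S↭ : S ↭ shared ++ onlyˡ
      T↭ : T ↭ shared ++ onlyʳ
      union⊆ : union ⊆ Γ
      union↭ : union ↭ shared ++ onlyˡ ++ onlyʳ

  ⊆-overlap : ∀ {S T Γ} → S ⊆ Γ → T ⊆ Γ → Overlap S T Γ
  ⊆-overlap [] [] = record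
    { shared = [] ; onlyˡ = [] ; onlyʳ = [] ; union = []
    ; S↭ = ↭-refl ; T↭ = ↭-refl ; union⊆ = [] ; union↭ = ↭-refl }
  ⊆-overlap (x ∷ʳ p) (x ∷ʳ q) = record
    { shared = shared ; onlyˡ = onlyˡ ; onlyʳ = onlyʳ ; union = union
    ; S↭ = S↭ ; T↭ = T↭ ; union⊆ = x ∷ʳ union⊆ ; union↭ = union↭ }
    where open Overlap (⊆-overlap p q)
  ⊆-overlap (_∷_ {x} refl p) (refl ∷ q) = record
    { shared = x ∷ shared ; onlyˡ = onlyˡ ; onlyʳ = onlyʳ ; union = x ∷ union
    ; S↭ = prep x S↭ ; T↭ = prep x T↭ ; union⊆ = refl ∷ union⊆ ; union↭ = prep x union↭ }
    where open Overlap (⊆-overlap p q)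
  ⊆-overlap (_∷_ {x} refl p) (x ∷ʳ q) = record
    { shared = shared ; onlyˡ = x ∷ onlyˡ ; onlyʳ = onlyʳ ; union = x ∷ union
    ; S↭ = ↭-trans (prep x S↭) (↭-sym (shift x shared onlyˡ)) ; T↭ = T↭
    ; union⊆ = refl ∷ union⊆ ; union↭ = ↭-trans (prep x union↭) (↭-sym (shift x shared (onlyˡ ++ onlyʳ))) }
    where open Overlap (⊆-overlap p q)
  ⊆-overlap (x ∷ʳ p) (_∷_ {x} refl q) = record
    { shared = shared ; onlyˡ = onlyˡ ; onlyʳ = x ∷ onlyʳ ; union = x ∷ union
    ; S↭ = S↭ ; T↭ = ↭-trans (prep x T↭) (↭-sym (shift x shared onlyʳ))
    ; union⊆ = refl ∷ union⊆
    ; union↭ = ↭-trans (prep x union↭)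
        (↭-trans (↭-sym (shift x shared (onlyˡ ++ onlyʳ))) (++⁺ˡ shared (↭-sym (shift x onlyˡ onlyʳ)))) }
    where open Overlap (⊆-overlap p q)

  pair-⊆ : ∀ {x y : A} {Γ} → x ≢ y → x ∈ Γ → y ∈ Γ → ∃[ S ] S ⊆ Γ × S ↭ x ∷ y ∷ []
  pair-⊆ x≢y (here refl) (here refl) = contradiction refl x≢y
  pair-⊆ _ (here refl) (there y∈Γ) = _ , refl ∷ from∈ y∈Γ , ↭-refl
  pair-⊆ _ (there x∈Γ) (here refl) = _ , refl ∷ from∈ x∈Γ , swap _ _ ↭-refl
  pair-⊆ x≢y (there x∈Γ) (there y∈Γ) = let (S , S⊆Γ , σ) = pair-⊆ x≢y x∈Γ y∈Γ in S , _ ∷ʳ S⊆Γ , σ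

Mp-nonempty : ∀ {Γ} → Mp Γ → Γ ≢ []
Mp-nonempty (perm ρ d) refl = Mp-nonempty d (↭-empty-inv ρ)
Mp-nonempty (conj Γ Δ Σ _ _ _ _) eq with () ← ++-conicalʳ Σ _ (++-conicalʳ Δ _ (++-conicalʳ Γ _ eq))
Mp-nonempty (par Γ _ _ _) eq with () ← ++-conicalʳ Γ _ eq
Mp-nonempty (⊕₁ Γ _ _ _) eq with () ← ++-conicalʳ Γ _ eq
Mp-nonempty (⊕₂ Γ _ _ _) eq with () ← ++-conicalʳ Γ _ eq

rotate : ∀ Γ Δ → Mp (Γ ++ Δ) → Mp (Δ ++ Γ)
rotate Γ Δ = perm (++-comm Γ Δ)

par-front : ∀ {Γ A B} → Mp (A ∷ B ∷ Γ) → Mp ((A ⊔ B) ∷ Γ)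
par-front {Γ} {A} {B} d = rotate Γ [ A ⊔ B ] (par Γ A B (rotate (A ∷ B ∷ []) Γ d))

⊕₁-front : ∀ {Γ A B} → Mp (A ∷ Γ) → Mp ((A ⊔ B) ∷ Γ)
⊕₁-front {Γ} {A} {B} d = rotate Γ [ A ⊔ B ] (⊕₁ Γ A B (rotate [ A ] Γ d))

⊕₂-front : ∀ {Γ A B} → Mp (B ∷ Γ) → Mp ((A ⊔ B) ∷ Γ)
⊕₂-front {Γ} {A} {B} d = rotate Γ [ A ⊔ B ] (⊕₂ Γ A B (rotate [ B ] Γ d))

conj-front : ∀ {Γ Δ Σ A B} → Mp (A ∷ Γ ++ Δ) → Mp (B ∷ Γ ++ Σ) → Mp ((A ⊓ B) ∷ Γ ++ Δ ++ Σ)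
conj-front {Γ} {Δ} {Σ} {A} {B} dA dB =
  rotate (Γ ++ Δ ++ Σ) [ A ⊓ B ] (subst Mp reassoc (conj Γ Δ Σ A B (back Δ dA) (back Σ dB)))
  where
  back : ∀ Θ {X} → Mp (X ∷ Γ ++ Θ) → Mp (Γ ++ Θ ++ [ X ])
  back Θ {X} d = subst Mp (++-assoc Γ Θ [ X ]) (rotate [ X ] (Γ ++ Θ) d)
  reassoc : Γ ++ Δ ++ Σ ++ [ A ⊓ B ] ≡ (Γ ++ Δ ++ Σ) ++ [ A ⊓ B ]
  reassoc = sym (Eq.trans (++-assoc Γ (Δ ++ Σ) _) (cong (Γ ++_) (++-assoc Δ Σ _)))

SubDerivable : Sequent → Set
SubDerivable Γ = ∃[ S ] S ⊆ Γ × Mp S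

SubDerivable-resp-↭ : ∀ {Γ Δ} → Γ ↭ Δ → SubDerivable Γ → SubDerivable Δ
SubDerivable-resp-↭ ρ (S , S⊆Γ , d) = let (S′ , σ , S′⊆Δ) = ⊆-transport S⊆Γ ρ in S′ , S′⊆Δ , perm σ d

SubDerivable-singleton : ∀ {A} → SubDerivable [ A ] → Derivable A
SubDerivable-singleton (_ , refl ∷ [] , d) = d
SubDerivable-singleton (_ , _ ∷ʳ [] , d) = contradiction refl (Mp-nonempty d)

⊔-subDerivable : ∀ {Γ A B} → SubDerivable (A ∷ B ∷ Γ) → SubDerivable ((A ⊔ B) ∷ Γ)
⊔-subDerivable (_ , refl ∷ refl ∷ p , d) = _ , refl ∷ p , par-front d
⊔-subDerivable (_ , refl ∷ _ ∷ʳ p , d) = _ , refl ∷ p , ⊕₁-front d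
⊔-subDerivable (_ , _ ∷ʳ refl ∷ p , d) = _ , refl ∷ p , ⊕₂-front d
⊔-subDerivable (S , _ ∷ʳ _ ∷ʳ p , d) = S , _ ∷ʳ p , d

⊓-subDerivable : ∀ {Γ A B} → SubDerivable (A ∷ Γ) → SubDerivable (B ∷ Γ) → SubDerivable ((A ⊓ B) ∷ Γ)
⊓-subDerivable (S , _ ∷ʳ p , d) _ = S , _ ∷ʳ p , d
⊓-subDerivable (_ , refl ∷ _ , _) (T , _ ∷ʳ q , d) = T , _ ∷ʳ q , d
⊓-subDerivable (_ , refl ∷ p , dA) (_ , refl ∷ q , dB) =
  _ ∷ union , refl ∷ union⊆ ,
  perm (prep _ (↭-sym union↭)) (conj-front {shared} {onlyˡ} {onlyʳ} (perm (prep _ S↭) dA) (perm (prep _ T↭) dB))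
  where open Overlap (⊆-overlap p q)

ValidSequent : Sequent → Set
ValidSequent Γ = ∀ ρ → Any (T ∘ eval ρ) Γ

ValidSequent-resp-↭ : ∀ {Γ Δ} → Γ ↭ Δ → ValidSequent Γ → ValidSequent Δ
ValidSequent-resp-↭ σ valid ρ = Any-resp-↭ σ (valid ρ)

⊔-valid⁻ : ∀ {Γ A B} → ValidSequent ((A ⊔ B) ∷ Γ) → ValidSequent (A ∷ B ∷ Γ)
⊔-valid⁻ valid ρ with valid ρ
... | there t = there (there t)
... | here t with Equivalence.to T-∨ t
...   | inj₁ tA = here tA
...   | inj₂ tB = there (here tB)

⊓-valid⁻ˡ : ∀ {Γ A B} → ValidSequent ((A ⊓ B) ∷ Γ) → ValidSequent (A ∷ Γ)
⊓-valid⁻ˡ valid ρ with valid ρ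
... | here t = here (proj₁ (Equivalence.to T-∧ t))
... | there t = there t

⊓-valid⁻ʳ : ∀ {Γ A B} → ValidSequent ((A ⊓ B) ∷ Γ) → ValidSequent (B ∷ Γ)
⊓-valid⁻ʳ valid ρ with valid ρ
... | here t = here (proj₂ (Equivalence.to T-∧ t))
... | there t = there t

data Literal : Formula → Set where
  positive : ∀ n → Literal (pos n)
  negative : ∀ n → Literal (neg n)

neg? : ∀ n F → Dec (neg n ≡ F)
neg? n (neg m) = map′ (cong neg) (λ { refl → refl }) (n ≟ m)
neg? n (pos _) = no λ ()
neg? n (_ ⊓ _) = no λ ()
neg? n (_ ⊔ _) = no λ ()

-- Under the assignment with Pₙ true iff P̄ₙ ∈ Γ, no P̄ₙ of Γ is true, and a true Pₙ has its complement in Γ.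
complementary-pair : ∀ {Γ} → All Literal Γ → ValidSequent Γ → ∃[ n ] pos n ∈ Γ × neg n ∈ Γ
complementary-pair {Γ} lits valid with find (valid (λ n → isYes (any? (neg? n) Γ)))
... | F , F∈Γ , F-true with All.lookup lits F∈Γ
...   | positive n = n , F∈Γ , toWitness {a? = any? (neg? n) Γ} F-true
...   | negative n = contradiction F∈Γ (toWitnessFalse {a? = any? (neg? n) Γ} F-true)

literals-subDerivable : ∀ {Γ} → All Literal Γ → ValidSequent Γ → SubDerivable Γ
literals-subDerivable lits valid =
  let (n , pos∈Γ , neg∈Γ) = complementary-pair lits valid
      (S , S⊆Γ , σ) = pair-⊆ (λ ()) pos∈Γ neg∈Γ
  in S , S⊆Γ , perm (↭-sym σ) (ax n)

data Focus (Γ : Sequent) : Set where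
  literals    : All Literal Γ → Focus Γ
  disjunction : ∀ {A B Γ′} → Γ ↭ (A ⊔ B) ∷ Γ′ → Focus Γ
  conjunction : ∀ {A B Γ′} → Γ ↭ (A ⊓ B) ∷ Γ′ → Focus Γ

literal∷-focus : ∀ {X Γ} → Literal X → Focus Γ → Focus (X ∷ Γ)
literal∷-focus l (literals ls) = literals (l ∷ ls)
literal∷-focus _ (disjunction σ) = disjunction (↭-trans (prep _ σ) (swap _ _ ↭-refl))
literal∷-focus _ (conjunction σ) = conjunction (↭-trans (prep _ σ) (swap _ _ ↭-refl))

focus : ∀ Γ → Focus Γ
focus [] = literals []
focus (pos n ∷ Γ) = literal∷-focus (positive n) (focus Γ)
focus (neg n ∷ Γ) = literal∷-focus (negative n) (focus Γ)
focus ((A ⊓ B) ∷ Γ) = conjunction ↭-refl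
focus ((A ⊔ B) ∷ Γ) = disjunction ↭-refl

formulaSize : Formula → ℕ
formulaSize (pos _) = 1
formulaSize (neg _) = 1
formulaSize (A ⊓ B) = suc (formulaSize A + formulaSize B)
formulaSize (A ⊔ B) = suc (formulaSize A + formulaSize B)

size : Sequent → ℕ
size Γ = sum (map formulaSize Γ)

size-resp-↭ : ∀ {Γ Δ} → Γ ↭ Δ → size Γ ≡ size Δ
size-resp-↭ σ = sum-↭ (map⁺ formulaSize σ)

size-⊔ : ∀ {Γ A B} → size (A ∷ B ∷ Γ) < size ((A ⊔ B) ∷ Γ)
size-⊔ {Γ} {A} {B} = s≤s (≤-reflexive (sym (+-assoc (formulaSize A) (formulaSize B) (size Γ))))

size-⊓ˡ : ∀ {Γ A B} → size (A ∷ Γ) < size ((A ⊓ B) ∷ Γ)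
size-⊓ˡ {Γ} {A} {B} = s≤s (+-monoˡ-≤ (size Γ) (m≤m+n (formulaSize A) (formulaSize B)))

size-⊓ʳ : ∀ {Γ A B} → size (B ∷ Γ) < size ((A ⊓ B) ∷ Γ)
size-⊓ʳ {Γ} {A} {B} = s≤s (+-monoˡ-≤ (size Γ) (m≤n+m (formulaSize B) (formulaSize A)))

valid⇒subDerivable : ∀ Γ → Acc _<_ (size Γ) → ValidSequent Γ → SubDerivable Γ
valid⇒subDerivable Γ (acc smaller) valid = by-focus (focus Γ)
  where
  premise : ∀ {X Γ′ Δ} → Γ ↭ X ∷ Γ′ → size Δ < size (X ∷ Γ′) →
            (ValidSequent (X ∷ Γ′) → ValidSequent Δ) → SubDerivable Δ
  premise σ Δ<Γ valid⁻ =
    valid⇒subDerivable _ (smaller (<-≤-trans Δ<Γ (≤-reflexive (sym (size-resp-↭ σ)))))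
      (valid⁻ (ValidSequent-resp-↭ σ valid))

  by-focus : Focus Γ → SubDerivable Γ
  by-focus (literals lits) = literals-subDerivable lits valid
  by-focus (disjunction {A} {B} {Γ′} σ) =
    SubDerivable-resp-↭ (↭-sym σ) (⊔-subDerivable (premise σ (size-⊔ {Γ′} {A} {B}) ⊔-valid⁻))
  by-focus (conjunction {A} {B} {Γ′} σ) =
    SubDerivable-resp-↭ (↭-sym σ)
      (⊓-subDerivable (premise σ (size-⊓ˡ {Γ′} {A} {B}) ⊓-valid⁻ˡ) (premise σ (size-⊓ʳ {Γ′} {A} {B}) ⊓-valid⁻ʳ))

theorem1 : (A : Formula) → Valid A → Derivable A
theorem1 A valid =
  SubDerivable-singleton (valid⇒subDerivable [ A ] (<-wellFounded _) valid-sequent)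
  where
  valid-sequent : ValidSequent [ A ]
  valid-sequent ρ = here (Equivalence.from T-≡ (valid ρ))
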